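{- Every regressive-flow formula is preserved under restrictions in the second sort. That is, if $\varphi(\bm{v}^\mathsf{p},\bm{v}^\mathsf{s})$ is a regressive-flow formula, $\langle X,r,A\rangle$ is a Chu space, $B\subseteq A$ and $s=r\cap(X\times B)$, then for all tuples $\bm{x}$ in $X$ and $\bm{b}$ in $B$, \[ \langle X,r,A\rangle\models\varphi[\bm{x},\bm{b}]\implies\langle X,s,B\rangle\models\varphi[\bm{x},\bm{b}]. \]
   Context: A Chu space is a triple $\langle X,r,A\rangle$ with $r\subseteq X\times A$. A restriction in the second sort from $\langle X,r,A\rangle$ to $\langle Y,s,B\rangle$ is the Chu transform $(\mathrm{id}_X,\mathrm{id}_B)$ where $X=Y$ and $B\subseteq A$; the Chu transform condition ($\langle x,g(b)\rangle\in r\iff\langle f(x),b\rangle\in s$) amounts to $s=r\cap(X\times B)$. Chu spaces are viewed as two-sorted structures (disjoint sorts: points, states) for the two-sorted infinitary language $\mathcal{L}^\mathrm{II}_{\infty,\infty}$, with point variables $v^\mathsf{p}$, state variables $v^\mathsf{s}$, atomic formulas $(v^\mathsf{p}_0=v^\mathsf{p}_1)$, $(v^\mathsf{s}_0=v^\mathsf{s}_1)$, $R(v^\mathsf{p},v^\mathsf{s})$ ($R$ interpreted as the relation of the space), and closed under negation, infinitary conjunctions/disjunctions, and quantification over possibly infinite tuples of either sort. The regressive-flow formulas are defined recursively: every atomic $\mathcal{L}^\mathrm{II}_{\infty,\infty}$-formula and every negation of one is a regressive-flow formula; infinitary conjunctions and disjunctions of regressive-flow formulas are regressive-flow; if $\varphi$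 is regressive-flow then $\exists\bm{v}^\mathsf{p}\varphi$, $\forall\bm{v}^\mathsf{p}\varphi$ and $\forall\bm{v}^\mathsf{s}\varphi$ are regressive-flow. -}

module Defs where

open import Level using (Level; suc)
open import Data.Product using (Σ; _,_; proj₁)
open import Data.Sum using (_⊎_; [_,_])
open import Relation.Binary.PropositionalEquality using (_≡_)
open import Relation.Nullary using (¬_)

record ChuSpace (ℓ : Level) : Set (suc ℓ) where
  field
    Pt  : Set ℓ
    St  : Set ℓ
    rel : Pt → St → Set ℓ
open ChuSpace public

-- A formula in context (P , S) has free point variables indexed by P and
-- free state variables indexed by S.
data Formula {ℓ : Level} : Set ℓ → Set ℓ → Set (suc ℓ) where
  eqᵖ : {P S : Set ℓ} → P → P → Formula P S
  eqˢ : {P S : Set ℓ} → S → S → Formula P S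
  R   : {P S : Set ℓ} → P → S → Formula P S
  ¬′  : {P S : Set ℓ} → Formula P S → Formula P S
  ⋀   : {P S : Set ℓ} (I : Set ℓ) → (I → Formula P S) → Formula P S
  ⋁   : {P S : Set ℓ} (I : Set ℓ) → (I → Formula P S) → Formula P S
  ∃ᵖ  : {P S : Set ℓ} (J : Set ℓ) → Formula (P ⊎ J) S → Formula P S
  ∀ᵖ  : {P S : Set ℓ} (J : Set ℓ) → Formula (P ⊎ J) S → Formula P S
  ∃ˢ  : {P S : Set ℓ} (J : Set ℓ) → Formula P (S ⊎ J) → Formula P S
  ∀ˢ  : {P S : Set ℓ} (J : Set ℓ) → Formula P (S ⊎ J) → Formula P S

Sat : ∀ {ℓ} (C : ChuSpace ℓ) {P S : Set ℓ} →
      Formula P S → (P → Pt C) → (S → St C) → Set ℓ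
Sat C (eqᵖ i j)  x a = x i ≡ x j
Sat C (eqˢ i j)  x a = a i ≡ a j
Sat C (R i j)    x a = rel C (x i) (a j)
Sat C (¬′ φ)     x a = ¬ Sat C φ x a
Sat C (⋀ I φ)    x a = (i : I) → Sat C (φ i) x a
Sat C (⋁ I φ)    x a = Σ I λ i → Sat C (φ i) x a
Sat C (∃ᵖ J φ)   x a = Σ (J → Pt C) λ y → Sat C φ [ x , y ] a
Sat C (∀ᵖ J φ)   x a = (y : J → Pt C) → Sat C φ [ x , y ] a
Sat C (∃ˢ J φ)   x a = Σ (J → St C) λ b → Sat C φ x [ a , b ]
Sat C (∀ˢ J φ)   x a = (b : J → St C) → Sat C φ x [ a , b ]

data Atomic {ℓ : Level} {P S : Set ℓ} : Formula P S → Set (suc ℓ) where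
  at-eqᵖ : (i j : P) → Atomic (eqᵖ i j)
  at-eqˢ : (i j : S) → Atomic (eqˢ i j)
  at-R   : (i : P) (j : S) → Atomic (R i j)

data RegressiveFlow {ℓ : Level} : {P S : Set ℓ} → Formula P S → Set (suc ℓ) where
  rf-atom : {P S : Set ℓ} {φ : Formula P S} → Atomic φ → RegressiveFlow φ
  rf-neg  : {P S : Set ℓ} {φ : Formula P S} → Atomic φ → RegressiveFlow (¬′ φ)
  rf-⋀    : {P S : Set ℓ} (I : Set ℓ) (φ : I → Formula P S) →
            ((i : I) → RegressiveFlow (φ i)) → RegressiveFlow (⋀ I φ)
  rf-⋁    : {P S : Set ℓ} (I : Set ℓ) (φ : I → Formula P S) →
            ((i : I) → RegressiveFlow (φ i)) → RegressiveFlow (⋁ I φ)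
  rf-∃ᵖ   : {P S : Set ℓ} (J : Set ℓ) {φ : Formula (P ⊎ J) S} →
            RegressiveFlow φ → RegressiveFlow (∃ᵖ J φ)
  rf-∀ᵖ   : {P S : Set ℓ} (J : Set ℓ) {φ : Formula (P ⊎ J) S} →
            RegressiveFlow φ → RegressiveFlow (∀ᵖ J φ)
  rf-∀ˢ   : {P S : Set ℓ} (J : Set ℓ) {φ : Formula P (S ⊎ J)} →
            RegressiveFlow φ → RegressiveFlow (∀ˢ J φ)

-- A subset B ⊆ A of the states (a proposition-valued predicate).
IsSubset : ∀ {ℓ} {A : Set ℓ} → (A → Set ℓ) → Set ℓ
IsSubset {A = A} B = (a : A) (p q : B a) → p ≡ q

restrict : ∀ {ℓ} (C : ChuSpace ℓ) → (St C → Set ℓ) → ChuSpace ℓ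
restrict C B = record
  { Pt  = Pt C
  ; St  = Σ (St C) B
  ; rel = λ x b → rel C x (proj₁ b)
  }

{-# OPTIONS --safe #-}
module Submission where

-- Atomic formulas are not only preserved but also reflected by the
-- restriction: s is r cut down to B, and an element of B is determined by its
-- underlying state because B is a subset.  Hence literals are preserved,
-- connectives and point quantifiers pass through unchanged, and ∀ over states
-- of B is an instance of ∀ over states of A.  Only ∃ over states, which is
-- excluded from the regressive-flow fragment, could fail.

open import Defs
open import Level using (Level)
open import Data.Product using (Σ; proj₁; _,_)
open import Data.Sum using (inj₁; inj₂; [_,_])
open import Function using (_∘_)
open import Relation.Binary.PropositionalEquality
  using (_≡_; _≗_; refl; sym; trans; cong; subst)

proj₁-injective : ∀ {ℓ} {A : Set ℓ} {B : A → Set ℓ} → IsSubset B →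
                  {u v : Σ A B} → proj₁ u ≡ proj₁ v → u ≡ v
proj₁-injective B-prop {a , p} {.a , q} refl = cong (a ,_) (B-prop a p q)

module _ {ℓ : Level} (C : ChuSpace ℓ) (B : St C → Set ℓ) where

  private
    C↾B : ChuSpace ℓ
    C↾B = restrict C B

  restrict-reflects-atomic : {P S : Set ℓ} {φ : Formula P S} → Atomic φ →
    (x : P → Pt C) {a : S → St C} {b : S → Σ (St C) B} → a ≗ proj₁ ∘ b →
    Sat C↾B φ x b → Sat C φ x a
  restrict-reflects-atomic (at-eqᵖ i j) x a≗b xi≡xj = xi≡xj
  restrict-reflects-atomic (at-eqˢ i j) x a≗b bi≡bj =
    trans (a≗b i) (trans (cong proj₁ bi≡bj) (sym (a≗b j)))
  restrict-reflects-atomic (at-R i j) x a≗b r = subst (rel C (x i)) (sym (a≗b j)) r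

  restrict-preserves-atomic : IsSubset B →
    {P S : Set ℓ} {φ : Formula P S} → Atomic φ →
    (x : P → Pt C) {a : S → St C} {b : S → Σ (St C) B} → a ≗ proj₁ ∘ b →
    Sat C φ x a → Sat C↾B φ x b
  restrict-preserves-atomic B-prop (at-eqᵖ i j) x a≗b xi≡xj = xi≡xj
  restrict-preserves-atomic B-prop (at-eqˢ i j) x a≗b ai≡aj =
    proj₁-injective B-prop (trans (sym (a≗b i)) (trans ai≡aj (a≗b j)))
  restrict-preserves-atomic B-prop (at-R i j) x a≗b r = subst (rel C (x i)) (a≗b j) r

  -- The state assignment of C is only pointwise equal to proj₁ ∘ b: under a
  -- state quantifier it becomes [ a , proj₁ ∘ c ], which is not definitionally
  -- proj₁ ∘ [ b , c ].
  restrict-preserves-regressiveFlow : IsSubset B →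
    {P S : Set ℓ} {φ : Formula P S} → RegressiveFlow φ →
    (x : P → Pt C) {a : S → St C} {b : S → Σ (St C) B} → a ≗ proj₁ ∘ b →
    Sat C φ x a → Sat C↾B φ x b
  restrict-preserves-regressiveFlow B-prop (rf-atom at) x a≗b =
    restrict-preserves-atomic B-prop at x a≗b
  restrict-preserves-regressiveFlow B-prop (rf-neg at) x a≗b ¬φ =
    ¬φ ∘ restrict-reflects-atomic at x a≗b
  restrict-preserves-regressiveFlow B-prop (rf-⋀ I φ rf) x a≗b ⋀φ i =
    restrict-preserves-regressiveFlow B-prop (rf i) x a≗b (⋀φ i)
  restrict-preserves-regressiveFlow B-prop (rf-⋁ I φ rf) x a≗b (i , φi) =
    i , restrict-preserves-regressiveFlow B-prop (rf i) x a≗b φi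
  restrict-preserves-regressiveFlow B-prop (rf-∃ᵖ J rf) x a≗b (y , φy) =
    y , restrict-preserves-regressiveFlow B-prop rf [ x , y ] a≗b φy
  restrict-preserves-regressiveFlow B-prop (rf-∀ᵖ J rf) x a≗b ∀φ y =
    restrict-preserves-regressiveFlow B-prop rf [ x , y ] a≗b (∀φ y)
  restrict-preserves-regressiveFlow B-prop (rf-∀ˢ J rf) x {a} {b} a≗b ∀φ c =
    restrict-preserves-regressiveFlow B-prop rf x extended-≗ (∀φ (proj₁ ∘ c))
    where
    extended-≗ : [ a , proj₁ ∘ c ] ≗ proj₁ ∘ [ b , c ]
    extended-≗ (inj₁ s) = a≗b s
    extended-≗ (inj₂ j) = refl

proposition3p13 : ∀ {ℓ : Level} {P S : Set ℓ} (φ : Formula P S) → RegressiveFlow φ →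
    (C : ChuSpace ℓ) (B : St C → Set ℓ) → IsSubset B →
    (x : P → Pt C) (b : S → Σ (St C) B) →
    Sat C φ x (proj₁ ∘ b) → Sat (restrict C B) φ x b
proposition3p13 φ rf C B B-prop x b =
  restrict-preserves-regressiveFlow C B B-prop rf x (λ _ → refl)
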